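{- Let $\phi$ be a formula and $\alpha$ a valuation. Every valuation occurring in the computation tree $[\![\phi]\!]_\alpha$ (as part of a node label or as a success leaf) extends $\alpha$ by pairs $x/d$ only for variables $x$ that occur free in $\phi$ or appear existentially quantified in $\phi$. Moreover, if $\phi$ is $\alpha$-closed, then every valuation occurring in $[\![\phi]\!]_\alpha$ extends $\alpha$ only by pairs $x/d$ for variables $x$ that appear existentially quantified in $\phi$.
   Context: Fix a first-order language with equality and an interpretation $I$ of it with domain $D$. A valuation is a finite single-valued set of pairs $x/d$ ($x$ a variable, $d\in D$); $\alpha'$ extends $\alpha$ if $\alpha\subseteq\alpha'$; $\varepsilon$ is the empty valuation. A term $t$ is $\alpha$-closed if all its variables get a value in $\alpha$, and then $t^\alpha\in D$ is its value under $\alpha$; a formula is $\alpha$-closed if all its free variables get a value in $\alpha$. An $\alpha$-assignment is an equation $s=t$ one side of which is a variable not assigned by $\alpha$ and the other side an $\alpha$-closed term. Formulas (no universal quantifier; conjunctions right-associative) are generated by: the empty conjunction $\Box$; $A\wedge\psi$ with $A$ an atom; $(\phi_1\vee\phi_2)\wedge\psi$; $(\phi_1\wedge\phi_2)\wedge\psi$; $(\phi_1\to\phi_2)\wedge\psi$; $\neg\phi\wedge\psi$; $\exists x\,\phi\wedge\psi$, where $\psi,\phi,\phi_1,\phi_2$ are formulas. The computation tree $[\![\phi]\!]_\alpha$ is a finite tree whose root is labelled $(\phi,\alpha)$, whose internal nodes are labelled by (formula, valuation) pairs, and whose leaves are labelled $\mathit{error}$, $\mathit{fail}$, or a valuation (a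 success leaf). It is defined by induction (lexicographically on the size of the formula and the size of its first conjunct): 1. $[\![\Box]\!]_\alpha$: the root has a single child, the success leaf $\alpha$. 2. $[\![A\wedge\psi]\!]_\alpha$, $A$ an atom: if $A$ is $\alpha$-closed and true in $I$ (under $\alpha$), the root's unique subtree is $[\![\psi]\!]_\alpha$; if $A$ is $\alpha$-closed and false, the root's unique child is $\mathit{fail}$; if $A$ is not $\alpha$-closed and not an $\alpha$-assignment, the unique child is $\mathit{error}$; if $A$ is an $\alpha$-assignment $x=t$ or $t=x$ with $x$ not assigned by $\alpha$ and $t$ $\alpha$-closed, the unique subtree is $[\![\psi]\!]_{\alpha\cup\{x/t^\alpha\}}$. 3. $[\![(\phi_1\vee\phi_2)\wedge\psi]\!]_\alpha$: root with two subtrees $[\![\phi_1\wedge\psi]\!]_\alpha$ and $[\![\phi_2\wedge\psi]\!]_\alpha$. 4. $[\![(\phi_1\wedge\phi_2)\wedge\psi]\!]_\alpha$: root with unique subtree $[\![\phi_1\wedge(\phi_2\wedge\psi)]\!]_\alpha$. 5. $[\![(\phi_1\to\phi_2)\wedge\psi]\!]_\alpha$: if $\phi_1$ is $\alpha$-closed and $[\![\phi_1]\!]_\alpha$ has only $\mathit{fail}$ leaves, unique subtree $[\![\psi]\!]_\alpha$; if $\phi_1$ is $\alpha$-closed and $[\![\phi_1]\!]_\alpha$ contains a success leaf, unique subtree $[\![\phi_2\wedge\psi]\!]_\alpha$; otherwise unique child $\mathit{error}$. 6. $[\![\neg\phi\wedge\psi]\!]_\alpha$: if $\phi$ is $\alpha$-closed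 and $[\![\phi]\!]_\alpha$ has only $\mathit{fail}$ leaves, unique subtree $[\![\psi]\!]_\alpha$; if $\phi$ is $\alpha$-closed and $[\![\phi]\!]_\alpha$ contains a success leaf, unique child $\mathit{fail}$; otherwise unique child $\mathit{error}$. 7. $[\![\exists x\,\phi\wedge\psi]\!]_\alpha$, where the bound variable $x$ is (after renaming) fresh, i.e. not in the domain of $\alpha$ and not occurring in $\psi$: unique subtree $[\![\phi\wedge\psi]\!]_\alpha$. -}

module Defs where

open import Data.Nat using (ℕ)
open import Data.List using (List; []; _∷_)
open import Data.List.Membership.Propositional using (_∈_)
open import Data.Vec using (Vec)
open import Data.Vec.Relation.Unary.Any using (Any)
open import Data.Vec.Relation.Binary.Pointwise.Inductive using (Pointwise)
open import Data.Product using (_×_; _,_; ∃)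
open import Data.Sum using (_⊎_)
open import Relation.Nullary using (¬_)
open import Relation.Binary.PropositionalEquality using (_≡_; _≢_)

Var : Set
Var = ℕ

record Signature : Set₁ where
  field
    Fn       : Set
    fnArity  : Fn → ℕ
    Rel      : Set
    relArity : Rel → ℕ

-- An interpretation with domain D.  Relations are interpreted as
-- (possibly undecidable) propositions; equality is interpreted as _≡_ on D.
record Interpretation (S : Signature) : Set₁ where
  open Signature S
  field
    D    : Set
    fnI  : (f : Fn) → Vec D (fnArity f) → D
    relI : (r : Rel) → Vec D (relArity r) → Set

module Syntax (S : Signature) where
  open Signature S

  data Term : Set where
    var : Var → Term
    fun : (f : Fn) → Vec Term (fnArity f) → Term

  data _occursIn_ (x : Var) : Term → Set where
    here  : x occursIn var x
    inArg : ∀ {f ts} → Any (x occursIn_) ts → x occursIn fun f ts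

  data Atom : Set where
    rel  : (r : Rel) → Vec Term (relArity r) → Atom
    _≐_  : Term → Term → Atom

  data _occursInAtom_ (x : Var) : Atom → Set where
    inRel   : ∀ {r ts} → Any (x occursIn_) ts → x occursInAtom rel r ts
    inLeft  : ∀ {s t} → x occursIn s → x occursInAtom (s ≐ t)
    inRight : ∀ {s t} → x occursIn t → x occursInAtom (s ≐ t)

  -- Formulas, following the grammar of the paper (right-associated
  -- conjunctions ending in the empty conjunction □):
  --   □ ;  A ∧ ψ ;  (φ₁ ∨ φ₂) ∧ ψ ;  (φ₁ ∧ φ₂) ∧ ψ ;  (φ₁ → φ₂) ∧ ψ ;
  --   ¬φ ∧ ψ ;  ∃x φ ∧ ψ
  data Formula : Set where
    □           : Formula
    at_∧_       : Atom → Formula → Formula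
    [_∨_]∧_     : Formula → Formula → Formula → Formula
    [_∧_]∧_     : Formula → Formula → Formula → Formula
    [_⇒_]∧_     : Formula → Formula → Formula → Formula
    [¬_]∧_      : Formula → Formula → Formula
    [∃_·_]∧_    : Var → Formula → Formula → Formula

  infixr 5 _⋀_
  _⋀_ : Formula → Formula → Formula
  □ ⋀ χ                = χ
  (at A ∧ ψ) ⋀ χ       = at A ∧ (ψ ⋀ χ)
  ([ φ₁ ∨ φ₂ ]∧ ψ) ⋀ χ = [ φ₁ ∨ φ₂ ]∧ (ψ ⋀ χ)
  ([ φ₁ ∧ φ₂ ]∧ ψ) ⋀ χ = [ φ₁ ∧ φ₂ ]∧ (ψ ⋀ χ)
  ([ φ₁ ⇒ φ₂ ]∧ ψ) ⋀ χ = [ φ₁ ⇒ φ₂ ]∧ (ψ ⋀ χ)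
  ([¬ φ ]∧ ψ) ⋀ χ      = [¬ φ ]∧ (ψ ⋀ χ)
  ([∃ x · φ ]∧ ψ) ⋀ χ  = [∃ x · φ ]∧ (ψ ⋀ χ)

  data _∈FV_ (x : Var) : Formula → Set where
    atA  : ∀ {A ψ} → x occursInAtom A → x ∈FV (at A ∧ ψ)
    atR  : ∀ {A ψ} → x ∈FV ψ → x ∈FV (at A ∧ ψ)
    or₁  : ∀ {φ₁ φ₂ ψ} → x ∈FV φ₁ → x ∈FV ([ φ₁ ∨ φ₂ ]∧ ψ)
    or₂  : ∀ {φ₁ φ₂ ψ} → x ∈FV φ₂ → x ∈FV ([ φ₁ ∨ φ₂ ]∧ ψ)
    orR  : ∀ {φ₁ φ₂ ψ} → x ∈FV ψ → x ∈FV ([ φ₁ ∨ φ₂ ]∧ ψ)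
    and₁ : ∀ {φ₁ φ₂ ψ} → x ∈FV φ₁ → x ∈FV ([ φ₁ ∧ φ₂ ]∧ ψ)
    and₂ : ∀ {φ₁ φ₂ ψ} → x ∈FV φ₂ → x ∈FV ([ φ₁ ∧ φ₂ ]∧ ψ)
    andR : ∀ {φ₁ φ₂ ψ} → x ∈FV ψ → x ∈FV ([ φ₁ ∧ φ₂ ]∧ ψ)
    imp₁ : ∀ {φ₁ φ₂ ψ} → x ∈FV φ₁ → x ∈FV ([ φ₁ ⇒ φ₂ ]∧ ψ)
    imp₂ : ∀ {φ₁ φ₂ ψ} → x ∈FV φ₂ → x ∈FV ([ φ₁ ⇒ φ₂ ]∧ ψ)
    impR : ∀ {φ₁ φ₂ ψ} → x ∈FV ψ → x ∈FV ([ φ₁ ⇒ φ₂ ]∧ ψ)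
    neg₁ : ∀ {φ ψ} → x ∈FV φ → x ∈FV ([¬ φ ]∧ ψ)
    negR : ∀ {φ ψ} → x ∈FV ψ → x ∈FV ([¬ φ ]∧ ψ)
    ex₁  : ∀ {y φ ψ} → x ≢ y → x ∈FV φ → x ∈FV ([∃ y · φ ]∧ ψ)
    exR  : ∀ {y φ ψ} → x ∈FV ψ → x ∈FV ([∃ y · φ ]∧ ψ)

  data _∈EV_ (x : Var) : Formula → Set where
    atR    : ∀ {A ψ} → x ∈EV ψ → x ∈EV (at A ∧ ψ)
    or₁    : ∀ {φ₁ φ₂ ψ} → x ∈EV φ₁ → x ∈EV ([ φ₁ ∨ φ₂ ]∧ ψ)
    or₂    : ∀ {φ₁ φ₂ ψ} → x ∈EV φ₂ → x ∈EV ([ φ₁ ∨ φ₂ ]∧ ψ)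
    orR    : ∀ {φ₁ φ₂ ψ} → x ∈EV ψ → x ∈EV ([ φ₁ ∨ φ₂ ]∧ ψ)
    and₁   : ∀ {φ₁ φ₂ ψ} → x ∈EV φ₁ → x ∈EV ([ φ₁ ∧ φ₂ ]∧ ψ)
    and₂   : ∀ {φ₁ φ₂ ψ} → x ∈EV φ₂ → x ∈EV ([ φ₁ ∧ φ₂ ]∧ ψ)
    andR   : ∀ {φ₁ φ₂ ψ} → x ∈EV ψ → x ∈EV ([ φ₁ ∧ φ₂ ]∧ ψ)
    imp₁   : ∀ {φ₁ φ₂ ψ} → x ∈EV φ₁ → x ∈EV ([ φ₁ ⇒ φ₂ ]∧ ψ)
    imp₂   : ∀ {φ₁ φ₂ ψ} → x ∈EV φ₂ → x ∈EV ([ φ₁ ⇒ φ₂ ]∧ ψ)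
    impR   : ∀ {φ₁ φ₂ ψ} → x ∈EV ψ → x ∈EV ([ φ₁ ⇒ φ₂ ]∧ ψ)
    neg₁   : ∀ {φ ψ} → x ∈EV φ → x ∈EV ([¬ φ ]∧ ψ)
    negR   : ∀ {φ ψ} → x ∈EV ψ → x ∈EV ([¬ φ ]∧ ψ)
    exHere : ∀ {φ ψ} → x ∈EV ([∃ x · φ ]∧ ψ)
    ex₁    : ∀ {y φ ψ} → x ∈EV φ → x ∈EV ([∃ y · φ ]∧ ψ)
    exR    : ∀ {y φ ψ} → x ∈EV ψ → x ∈EV ([∃ y · φ ]∧ ψ)

  -- x occurs in ψ (free, bound, or as a binder).  Every bound occurrence of
  -- x lies under some ∃x, so this is "free or existentially quantified".
  OccursF : Var → Formula → Set
  OccursF x ψ = x ∈FV ψ ⊎ x ∈EV ψ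

module Semantics {S : Signature} (I : Interpretation S) where
  open Signature S
  open Interpretation I
  open Syntax S

  -- A valuation: a finite set of pairs x/d, represented as a list;
  -- single-valuedness is a separate predicate.
  Valuation : Set
  Valuation = List (Var × D)

  SingleValued : Valuation → Set
  SingleValued α = ∀ {x d e} → (x , d) ∈ α → (x , e) ∈ α → d ≡ e

  Assigned : Valuation → Var → Set
  Assigned α x = ∃ λ d → (x , d) ∈ α

  ClosedTerm : Valuation → Term → Set
  ClosedTerm α t = ∀ x → x occursIn t → Assigned α x

  ClosedAtom : Valuation → Atom → Set
  ClosedAtom α A = ∀ x → x occursInAtom A → Assigned α x

  ClosedFormula : Valuation → Formula → Set
  ClosedFormula α φ = ∀ x → x ∈FV φ → Assigned α x

  data Eval (α : Valuation) : Term → D → Set where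
    evVar : ∀ {x d} → (x , d) ∈ α → Eval α (var x) d
    evFun : ∀ {f ts ds} → Pointwise (Eval α) ts ds → Eval α (fun f ts) (fnI f ds)

  Holds : Valuation → Atom → Set
  Holds α (rel r ts) = ∃ λ ds → Pointwise (Eval α) ts ds × relI r ds
  Holds α (s ≐ t)    = ∃ λ d → Eval α s d × Eval α t d

  data IsAssignment (α : Valuation) : Atom → Set where
    asgL : ∀ {x t} → ¬ Assigned α x → ClosedTerm α t → IsAssignment α (var x ≐ t)
    asgR : ∀ {x t} → ¬ Assigned α x → ClosedTerm α t → IsAssignment α (t ≐ var x)

  data Tree : Set where
    node    : Formula → Valuation → List Tree → Tree
    error   : Tree
    fail    : Tree
    success : Valuation → Tree

  data LeafOf : Tree → Tree → Set where
    error   : LeafOf error error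
    fail    : LeafOf fail fail
    success : ∀ {β} → LeafOf (success β) (success β)
    child   : ∀ {ℓ t φ α ts} → t ∈ ts → LeafOf ℓ t → LeafOf ℓ (node φ α ts)

  OnlyFail : Tree → Set
  OnlyFail t = ∀ ℓ → LeafOf ℓ t → ℓ ≡ fail

  HasSuccess : Tree → Set
  HasSuccess t = ∃ λ β → LeafOf (success β) t

  -- CT φ α t : t is the computation tree ⟦φ⟧_α  (clauses 1–7 of the paper)
  data CT : Formula → Valuation → Tree → Set where
    empty     : ∀ {α} → CT □ α (node □ α (success α ∷ []))
    atomTrue  : ∀ {A ψ α t} → ClosedAtom α A → Holds α A → CT ψ α t →
                CT (at A ∧ ψ) α (node (at A ∧ ψ) α (t ∷ []))
    atomFalse : ∀ {A ψ α} → ClosedAtom α A → ¬ Holds α A →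
                CT (at A ∧ ψ) α (node (at A ∧ ψ) α (fail ∷ []))
    atomError : ∀ {A ψ α} → ¬ ClosedAtom α A → ¬ IsAssignment α A →
                CT (at A ∧ ψ) α (node (at A ∧ ψ) α (error ∷ []))
    assignL   : ∀ {x t ψ α d s} → ¬ Assigned α x → ClosedTerm α t → Eval α t d →
                CT ψ ((x , d) ∷ α) s →
                CT (at (var x ≐ t) ∧ ψ) α (node (at (var x ≐ t) ∧ ψ) α (s ∷ []))
    assignR   : ∀ {x t ψ α d s} → ¬ Assigned α x → ClosedTerm α t → Eval α t d →
                CT ψ ((x , d) ∷ α) s →
                CT (at (t ≐ var x) ∧ ψ) α (node (at (t ≐ var x) ∧ ψ) α (s ∷ []))
    or        : ∀ {φ₁ φ₂ ψ α t₁ t₂} → CT (φ₁ ⋀ ψ) α t₁ → CT (φ₂ ⋀ ψ) α t₂ →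
                CT ([ φ₁ ∨ φ₂ ]∧ ψ) α (node ([ φ₁ ∨ φ₂ ]∧ ψ) α (t₁ ∷ t₂ ∷ []))
    and       : ∀ {φ₁ φ₂ ψ α t} → CT (φ₁ ⋀ (φ₂ ⋀ ψ)) α t →
                CT ([ φ₁ ∧ φ₂ ]∧ ψ) α (node ([ φ₁ ∧ φ₂ ]∧ ψ) α (t ∷ []))
    impFail   : ∀ {φ₁ φ₂ ψ α t₁ t} → ClosedFormula α φ₁ → CT φ₁ α t₁ → OnlyFail t₁ →
                CT ψ α t →
                CT ([ φ₁ ⇒ φ₂ ]∧ ψ) α (node ([ φ₁ ⇒ φ₂ ]∧ ψ) α (t ∷ []))
    impSucc   : ∀ {φ₁ φ₂ ψ α t₁ t} → ClosedFormula α φ₁ → CT φ₁ α t₁ → HasSuccess t₁ →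
                CT (φ₂ ⋀ ψ) α t →
                CT ([ φ₁ ⇒ φ₂ ]∧ ψ) α (node ([ φ₁ ⇒ φ₂ ]∧ ψ) α (t ∷ []))
    impErrorO : ∀ {φ₁ φ₂ ψ α} → ¬ ClosedFormula α φ₁ →
                CT ([ φ₁ ⇒ φ₂ ]∧ ψ) α (node ([ φ₁ ⇒ φ₂ ]∧ ψ) α (error ∷ []))
    impErrorC : ∀ {φ₁ φ₂ ψ α t₁} → ClosedFormula α φ₁ → CT φ₁ α t₁ →
                ¬ OnlyFail t₁ → ¬ HasSuccess t₁ →
                CT ([ φ₁ ⇒ φ₂ ]∧ ψ) α (node ([ φ₁ ⇒ φ₂ ]∧ ψ) α (error ∷ []))
    negFail   : ∀ {φ ψ α t₁ t} → ClosedFormula α φ → CT φ α t₁ → OnlyFail t₁ →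
                CT ψ α t →
                CT ([¬ φ ]∧ ψ) α (node ([¬ φ ]∧ ψ) α (t ∷ []))
    negSucc   : ∀ {φ ψ α t₁} → ClosedFormula α φ → CT φ α t₁ → HasSuccess t₁ →
                CT ([¬ φ ]∧ ψ) α (node ([¬ φ ]∧ ψ) α (fail ∷ []))
    negErrorO : ∀ {φ ψ α} → ¬ ClosedFormula α φ →
                CT ([¬ φ ]∧ ψ) α (node ([¬ φ ]∧ ψ) α (error ∷ []))
    negErrorC : ∀ {φ ψ α t₁} → ClosedFormula α φ → CT φ α t₁ →
                ¬ OnlyFail t₁ → ¬ HasSuccess t₁ →
                CT ([¬ φ ]∧ ψ) α (node ([¬ φ ]∧ ψ) α (error ∷ []))
    exists    : ∀ {x φ ψ α t} → ¬ Assigned α x → ¬ OccursF x ψ →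
                CT (φ ⋀ ψ) α t →
                CT ([∃ x · φ ]∧ ψ) α (node ([∃ x · φ ]∧ ψ) α (t ∷ []))

  data OccursVal (β : Valuation) : Tree → Set where
    atNode  : ∀ {φ ts} → OccursVal β (node φ β ts)
    atLeaf  : OccursVal β (success β)
    inChild : ∀ {φ α t ts} → t ∈ ts → OccursVal β t → OccursVal β (node φ α ts)

module Submission where

-- A computation tree only ever enlarges the valuation at an assignment
-- step x = t, and then x is not yet assigned.  The invariant carried down
-- the tree is therefore: every new pair x/d of a valuation in ⟦φ⟧_α has x
-- either existentially quantified in φ, or free in φ and unassigned by α.
-- Each continuation formula (ψ, φ₁ ∧ ψ, φ ∧ ψ under ∃x, ...) has its free
-- variables among the free or quantified variables of φ, so the invariant
-- is inherited by subtrees.  When φ is α-closed its free variables are all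
-- assigned by α, which leaves only the quantified ones.

open import Defs
open import Data.List using (_∷_; [])
open import Data.List.Membership.Propositional using (_∈_)
open import Data.List.Relation.Binary.Subset.Propositional using (_⊆_)
open import Data.List.Relation.Unary.Any using (here; there)
open import Data.Nat using (_≟_)
open import Data.Product using (_×_; _,_)
open import Data.Sum using (_⊎_; inj₁; inj₂; [_,_]; map₁; map₂)
open import Function using (_∘_; id)
open import Relation.Nullary using (¬_; yes; no; contradiction)
open import Relation.Binary.PropositionalEquality using (refl)

module _ {S : Signature} where
  open Syntax S

  ∈FV-⋀⁻ : ∀ {x} φ ψ → x ∈FV (φ ⋀ ψ) → x ∈FV φ ⊎ x ∈FV ψ
  ∈FV-⋀⁻ □                ψ p        = inj₂ p
  ∈FV-⋀⁻ (at A ∧ φ)       ψ (atA p)  = inj₁ (atA p)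
  ∈FV-⋀⁻ (at A ∧ φ)       ψ (atR p)  = map₁ atR (∈FV-⋀⁻ φ ψ p)
  ∈FV-⋀⁻ ([ _ ∨ _ ]∧ φ)   ψ (or₁ p)  = inj₁ (or₁ p)
  ∈FV-⋀⁻ ([ _ ∨ _ ]∧ φ)   ψ (or₂ p)  = inj₁ (or₂ p)
  ∈FV-⋀⁻ ([ _ ∨ _ ]∧ φ)   ψ (orR p)  = map₁ orR (∈FV-⋀⁻ φ ψ p)
  ∈FV-⋀⁻ ([ _ ∧ _ ]∧ φ)   ψ (and₁ p) = inj₁ (and₁ p)
  ∈FV-⋀⁻ ([ _ ∧ _ ]∧ φ)   ψ (and₂ p) = inj₁ (and₂ p)
  ∈FV-⋀⁻ ([ _ ∧ _ ]∧ φ)   ψ (andR p) = map₁ andR (∈FV-⋀⁻ φ ψ p)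
  ∈FV-⋀⁻ ([ _ ⇒ _ ]∧ φ)   ψ (imp₁ p) = inj₁ (imp₁ p)
  ∈FV-⋀⁻ ([ _ ⇒ _ ]∧ φ)   ψ (imp₂ p) = inj₁ (imp₂ p)
  ∈FV-⋀⁻ ([ _ ⇒ _ ]∧ φ)   ψ (impR p) = map₁ impR (∈FV-⋀⁻ φ ψ p)
  ∈FV-⋀⁻ ([¬ _ ]∧ φ)      ψ (neg₁ p) = inj₁ (neg₁ p)
  ∈FV-⋀⁻ ([¬ _ ]∧ φ)      ψ (negR p) = map₁ negR (∈FV-⋀⁻ φ ψ p)
  ∈FV-⋀⁻ ([∃ _ · _ ]∧ φ)  ψ (ex₁ n p) = inj₁ (ex₁ n p)
  ∈FV-⋀⁻ ([∃ _ · _ ]∧ φ)  ψ (exR p)  = map₁ exR (∈FV-⋀⁻ φ ψ p)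

  ∈EV-⋀⁻ : ∀ {x} φ ψ → x ∈EV (φ ⋀ ψ) → x ∈EV φ ⊎ x ∈EV ψ
  ∈EV-⋀⁻ □                ψ p        = inj₂ p
  ∈EV-⋀⁻ (at A ∧ φ)       ψ (atR p)  = map₁ atR (∈EV-⋀⁻ φ ψ p)
  ∈EV-⋀⁻ ([ _ ∨ _ ]∧ φ)   ψ (or₁ p)  = inj₁ (or₁ p)
  ∈EV-⋀⁻ ([ _ ∨ _ ]∧ φ)   ψ (or₂ p)  = inj₁ (or₂ p)
  ∈EV-⋀⁻ ([ _ ∨ _ ]∧ φ)   ψ (orR p)  = map₁ orR (∈EV-⋀⁻ φ ψ p)
  ∈EV-⋀⁻ ([ _ ∧ _ ]∧ φ)   ψ (and₁ p) = inj₁ (and₁ p)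
  ∈EV-⋀⁻ ([ _ ∧ _ ]∧ φ)   ψ (and₂ p) = inj₁ (and₂ p)
  ∈EV-⋀⁻ ([ _ ∧ _ ]∧ φ)   ψ (andR p) = map₁ andR (∈EV-⋀⁻ φ ψ p)
  ∈EV-⋀⁻ ([ _ ⇒ _ ]∧ φ)   ψ (imp₁ p) = inj₁ (imp₁ p)
  ∈EV-⋀⁻ ([ _ ⇒ _ ]∧ φ)   ψ (imp₂ p) = inj₁ (imp₂ p)
  ∈EV-⋀⁻ ([ _ ⇒ _ ]∧ φ)   ψ (impR p) = map₁ impR (∈EV-⋀⁻ φ ψ p)
  ∈EV-⋀⁻ ([¬ _ ]∧ φ)      ψ (neg₁ p) = inj₁ (neg₁ p)
  ∈EV-⋀⁻ ([¬ _ ]∧ φ)      ψ (negR p) = map₁ negR (∈EV-⋀⁻ φ ψ p)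
  ∈EV-⋀⁻ ([∃ _ · _ ]∧ φ)  ψ exHere   = inj₁ exHere
  ∈EV-⋀⁻ ([∃ _ · _ ]∧ φ)  ψ (ex₁ p)  = inj₁ (ex₁ p)
  ∈EV-⋀⁻ ([∃ _ · _ ]∧ φ)  ψ (exR p)  = map₁ exR (∈EV-⋀⁻ φ ψ p)

  record _≼_ (φ′ φ : Formula) : Set where
    field
      fv : ∀ {x} → x ∈FV φ′ → x ∈FV φ ⊎ x ∈EV φ
      ev : ∀ {x} → x ∈EV φ′ → x ∈EV φ
  open _≼_

  ≼-from-⊆ : ∀ {φ′ φ} → (∀ {x} → x ∈FV φ′ → x ∈FV φ) → (∀ {x} → x ∈EV φ′ → x ∈EV φ) →
             φ′ ≼ φ
  ≼-from-⊆ f g = record { fv = inj₁ ∘ f ; ev = g }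

  ⋀-≼ : ∀ {φ ψ χ} → φ ≼ χ → ψ ≼ χ → (φ ⋀ ψ) ≼ χ
  ⋀-≼ {φ} {ψ} φ≼χ ψ≼χ = record
    { fv = [ fv φ≼χ , fv ψ≼χ ] ∘ ∈FV-⋀⁻ φ ψ
    ; ev = [ ev φ≼χ , ev ψ≼χ ] ∘ ∈EV-⋀⁻ φ ψ
    }

  -- A free occurrence of the bound variable x in the body counts as a
  -- quantified occurrence in ∃x φ ∧ ψ.
  ∃-body-≼ : ∀ {x φ ψ} → φ ≼ ([∃ x · φ ]∧ ψ)
  ∃-body-≼ {x} = record { fv = fv-body ; ev = ex₁ }
    where
    fv-body : ∀ {z φ ψ} → z ∈FV φ → z ∈FV ([∃ x · φ ]∧ ψ) ⊎ z ∈EV ([∃ x · φ ]∧ ψ)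
    fv-body {z} p with z ≟ x
    ... | yes refl = inj₂ exHere
    ... | no z≢x   = inj₁ (ex₁ z≢x p)

module Invariant {S : Signature} (I : Interpretation S) where
  open Syntax S
  open Semantics I
  open _≼_

  Introducible : Valuation → Formula → Var → Set
  Introducible α φ x = (x ∈FV φ × ¬ Assigned α x) ⊎ x ∈EV φ

  Extends : Valuation → Formula → Valuation → Set
  Extends α φ β = α ⊆ β × (∀ x d → (x , d) ∈ β → (x , d) ∈ α ⊎ Introducible α φ x)

  Extends-refl : ∀ {α φ} → Extends α φ α
  Extends-refl = id , λ _ _ → inj₁

  Extends-≼ : ∀ {α φ′ φ β} → φ′ ≼ φ → Extends α φ′ β → Extends α φ β
  Extends-≼ {α} {φ′} {φ} φ′≼φ (α⊆β , new) = α⊆β , λ x d → map₂ introducible ∘ new x d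
    where
    introducible : ∀ {x} → Introducible α φ′ x → Introducible α φ x
    introducible (inj₁ (p , x∉α)) = map₁ (_, x∉α) (fv φ′≼φ p)
    introducible (inj₂ p)         = inj₂ (ev φ′≼φ p)

  Extends-assign : ∀ {x d α ψ β A} → ¬ Assigned α x → x occursInAtom A →
                   Extends ((x , d) ∷ α) ψ β → Extends α (at A ∧ ψ) β
  Extends-assign {x} {d} {α} {ψ} {A = A} x∉α x∈A (xα⊆β , new) =
    xα⊆β ∘ there , λ z e → step ∘ new z e
    where
    step : ∀ {z e} → (z , e) ∈ (x , d) ∷ α ⊎ Introducible ((x , d) ∷ α) ψ z →
           (z , e) ∈ α ⊎ Introducible α (at A ∧ ψ) z
    step (inj₁ (here refl))         = inj₂ (inj₁ (atA x∈A , x∉α))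
    step (inj₁ (there p))           = inj₁ p
    step (inj₂ (inj₁ (p , z∉xα)))   = inj₂ (inj₁ (atR p , λ (e , q) → z∉xα (e , there q)))
    step (inj₂ (inj₂ p))            = inj₂ (inj₂ (atR p))

  Introducible⇒occurs : ∀ {α φ x} → Introducible α φ x → x ∈FV φ ⊎ x ∈EV φ
  Introducible⇒occurs = map₁ (λ (p , _) → p)

  Introducible-closed : ∀ {α φ x} → ClosedFormula α φ → Introducible α φ x → x ∈EV φ
  Introducible-closed closed (inj₁ (p , x∉α)) = contradiction (closed _ p) x∉α
  Introducible-closed closed (inj₂ p)         = p

  Extends-map : ∀ {α φ β} {Q : Var → Set} → (∀ {x} → Introducible α φ x → Q x) →
                Extends α φ β → α ⊆ β × (∀ x d → (x , d) ∈ β → (x , d) ∈ α ⊎ Q x)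
  Extends-map f (α⊆β , new) = α⊆β , λ x d → map₂ f ∘ new x d

  Everywhere : (Valuation → Set) → Tree → Set
  Everywhere P t = ∀ β → OccursVal β t → P β

  Everywhere-map : ∀ {P Q : Valuation → Set} {t} → (∀ {β} → P β → Q β) →
                   Everywhere P t → Everywhere Q t
  Everywhere-map f all β p = f (all β p)

  Everywhere-≼ : ∀ {α φ′ φ t} → φ′ ≼ φ → Everywhere (Extends α φ′) t → Everywhere (Extends α φ) t
  Everywhere-≼ φ′≼φ = Everywhere-map (Extends-≼ φ′≼φ)

  Everywhere-fail : ∀ {P} → Everywhere P fail
  Everywhere-fail _ ()

  Everywhere-error : ∀ {P} → Everywhere P error
  Everywhere-error _ ()

  Everywhere-success : ∀ {P β} → P β → Everywhere P (success β)
  Everywhere-success Pβ _ atLeaf = Pβ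

  Everywhere-node₁ : ∀ {P φ α s} → P α → Everywhere P s →
                     Everywhere P (node φ α (s ∷ []))
  Everywhere-node₁ Pα all _ atNode                   = Pα
  Everywhere-node₁ Pα all β (inChild (here refl) p)  = all β p

  Everywhere-node₂ : ∀ {P φ α s₁ s₂} → P α → Everywhere P s₁ → Everywhere P s₂ →
                     Everywhere P (node φ α (s₁ ∷ s₂ ∷ []))
  Everywhere-node₂ Pα all₁ all₂ _ atNode                          = Pα
  Everywhere-node₂ Pα all₁ all₂ β (inChild (here refl) p)         = all₁ β p
  Everywhere-node₂ Pα all₁ all₂ β (inChild (there (here refl)) p) = all₂ β p

  CT⇒Extends : ∀ {φ α t} → CT φ α t → Everywhere (Extends α φ) t
  CT⇒Extends empty = Everywhere-node₁ Extends-refl (Everywhere-success Extends-refl)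
  CT⇒Extends (atomTrue _ _ c) =
    Everywhere-node₁ Extends-refl (Everywhere-≼ (≼-from-⊆ atR atR) (CT⇒Extends c))
  CT⇒Extends (atomFalse _ _) = Everywhere-node₁ Extends-refl Everywhere-fail
  CT⇒Extends (atomError _ _) = Everywhere-node₁ Extends-refl Everywhere-error
  CT⇒Extends (assignL x∉α _ _ c) =
    Everywhere-node₁ Extends-refl (Everywhere-map (Extends-assign x∉α (inLeft here)) (CT⇒Extends c))
  CT⇒Extends (assignR x∉α _ _ c) =
    Everywhere-node₁ Extends-refl (Everywhere-map (Extends-assign x∉α (inRight here)) (CT⇒Extends c))
  CT⇒Extends (or c₁ c₂) = Everywhere-node₂ Extends-refl
    (Everywhere-≼ (⋀-≼ (≼-from-⊆ or₁ or₁) (≼-from-⊆ orR orR)) (CT⇒Extends c₁))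
    (Everywhere-≼ (⋀-≼ (≼-from-⊆ or₂ or₂) (≼-from-⊆ orR orR)) (CT⇒Extends c₂))
  CT⇒Extends (and c) = Everywhere-node₁ Extends-refl (Everywhere-≼
    (⋀-≼ (≼-from-⊆ and₁ and₁) (⋀-≼ (≼-from-⊆ and₂ and₂) (≼-from-⊆ andR andR))) (CT⇒Extends c))
  CT⇒Extends (impFail _ _ _ c) =
    Everywhere-node₁ Extends-refl (Everywhere-≼ (≼-from-⊆ impR impR) (CT⇒Extends c))
  CT⇒Extends (impSucc _ _ _ c) = Everywhere-node₁ Extends-refl
    (Everywhere-≼ (⋀-≼ (≼-from-⊆ imp₂ imp₂) (≼-from-⊆ impR impR)) (CT⇒Extends c))
  CT⇒Extends (impErrorO _) = Everywhere-node₁ Extends-refl Everywhere-error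
  CT⇒Extends (impErrorC _ _ _ _) = Everywhere-node₁ Extends-refl Everywhere-error
  CT⇒Extends (negFail _ _ _ c) =
    Everywhere-node₁ Extends-refl (Everywhere-≼ (≼-from-⊆ negR negR) (CT⇒Extends c))
  CT⇒Extends (negSucc _ _ _) = Everywhere-node₁ Extends-refl Everywhere-fail
  CT⇒Extends (negErrorO _) = Everywhere-node₁ Extends-refl Everywhere-error
  CT⇒Extends (negErrorC _ _ _ _) = Everywhere-node₁ Extends-refl Everywhere-error
  CT⇒Extends (exists _ _ c) = Everywhere-node₁ Extends-refl
    (Everywhere-≼ (⋀-≼ ∃-body-≼ (≼-from-⊆ exR exR)) (CT⇒Extends c))

lemma1 : (S : Signature) (I : Interpretation S) →
         let open Syntax S
             open Semantics I
             open Interpretation I using (D)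
         in (φ : Formula) (α : Valuation) (t : Tree) →
            SingleValued α → CT φ α t →
            ((β : Valuation) → OccursVal β t →
               α ⊆ β × ((x : Var) (d : D) → (x , d) ∈ β →
                          (x , d) ∈ α ⊎ (x ∈FV φ ⊎ x ∈EV φ)))
            ×
            (ClosedFormula α φ →
               (β : Valuation) → OccursVal β t →
               α ⊆ β × ((x : Var) (d : D) → (x , d) ∈ β →
                          (x , d) ∈ α ⊎ x ∈EV φ))
lemma1 S I φ α t _ c =
    (λ β → Extends-map Introducible⇒occurs ∘ CT⇒Extends c β)
  , (λ closed β → Extends-map (Introducible-closed closed) ∘ CT⇒Extends c β)
  where open Invariant I
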